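{- For any feasible instance of the vehicle routing problem with subtours (defined in the context), with $n=|P|$ and $c(x,y):=c(\mu(x),\mu(y))$, the following hold: (a) $\Delta\ge\min\{c(r,q)+\delta+\min\{|Q|,n-1\}: q\in Q\}$ for every nonempty subset $Q\subseteq P$; (b) $\Delta\ge n$; (c) $\Delta\ge\max\{c(r,p):p\in P\}$.
   Context: An instance consists of a finite nonempty item set $P$, a root $r\notin P$, a metric space $(M,c)$, a map $\mu:\{r\}\cup P\to M$, and non-negative parameters $\delta,\sigma,\Delta$, with the standing assumption $\delta\ge1$. A schedule is an arborescence $(W,A)$ rooted at $r$ with $P\subseteq W$, together with an extension of $\mu$ to $W$. Every vertex has out-degree at most $2$, and vertices of $P$ have out-degree at most $1$. $W_2$ is the set of out-degree-$2$ vertices. $W_{x*}$ is the vertex set of the subarborescence rooted at $x$. $W_{ry}$ and $A_{ry}$ are the vertex and arc sets of the $r$-$y$-path. The delay of the schedule is $\max_{p\in P}\mathrm{delay}(r,p)$, where $$\mathrm{delay}(r,y)=\sum_{(u,v)\in A_{ry}}c(\mu(u),\mu(v))+\delta|P\cap W_{ry}|+\sum_{w\in W_{ry}\cap W_2}\min_{(w,x)\in A}|P\cap W_{x*}|.$$ The instance is feasible if some schedule has delay at most $\Delta$.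
   Formalization: The distances of the metric space $(M,c)$ and the parameters $\delta,\sigma,\Delta$ are rational. -}

module Defs where

open import Data.Nat using (ℕ; zero; suc; _⊓_; _∸_)
open import Data.Integer using (+_)
open import Data.Rational using (ℚ; _+_; _≤_; _/_; 0ℚ; 1ℚ)
open import Data.Fin using (Fin)
open import Data.List using (List; []; _∷_; _++_; length; allFin)
open import Data.List.Relation.Unary.All using (All)
open import Data.List.Relation.Binary.Permutation.Propositional using (_↭_)
open import Data.Product using (Σ; _×_; ∃)
open import Relation.Binary.PropositionalEquality using (_≡_)

toℚ : ℕ → ℚ
toℚ k = + k / 1

record IsMetric {M : Set} (c : M → M → ℚ) : Set where
  field
    nonneg   : ∀ x y → 0ℚ ≤ c x y
    zero-iff : ∀ x y → c x y ≡ 0ℚ → x ≡ y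
    refl0    : ∀ x → c x x ≡ 0ℚ
    symm     : ∀ x y → c x y ≡ c y x
    triangle : ∀ x y z → c x z ≤ c x y + c y z

-- Subarborescences hanging below a vertex of a schedule.
-- Items are Fin n (P = Fin n); other vertices (W \ ({r} ∪ P)) carry their location in M.
-- A vertex of P has out-degree ≤ 1 (constructors itm0/itm1); a non-item vertex
-- has out-degree 0, 1 or 2 (constructor pt with Kids).
mutual
  data Tree (n : ℕ) (M : Set) : Set where
    itm0 : Fin n → Tree n M
    itm1 : Fin n → Tree n M → Tree n M
    pt   : M → Kids n M → Tree n M

  data Kids (n : ℕ) (M : Set) : Set where
    k0 : Kids n M
    k1 : Tree n M → Kids n M
    k2 : Tree n M → Tree n M → Kids n M

-- A schedule is given by the children of the root r (out-degree ≤ 2),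
-- located at μ r.
Schedule : ℕ → Set → Set
Schedule n M = Kids n M

mutual
  itemsT : ∀ {n M} → Tree n M → List (Fin n)
  itemsT (itm0 p)   = p ∷ []
  itemsT (itm1 p t) = p ∷ itemsT t
  itemsT (pt _ k)   = itemsK k

  itemsK : ∀ {n M} → Kids n M → List (Fin n)
  itemsK k0       = []
  itemsK (k1 t)   = itemsT t
  itemsK (k2 t u) = itemsT t ++ itemsT u

-- Arguments: distance c, item locations μ,
-- δ, location of the parent, accumulated delay at the parent.
-- For an item vertex y: delay(r,y) = arc costs along the r-y path
--   + δ·|P ∩ W_{ry}| + Σ_{w ∈ W_{ry} ∩ W_2} min_{(w,x)∈A} |P ∩ W_{x*}|.
mutual
  delaysT : ∀ {n M} → (M → M → ℚ) → (Fin n → M) → ℚ → M → ℚ → Tree n M → List ℚ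
  delaysT c μ δ loc acc (itm0 p)   = (acc + c loc (μ p) + δ) ∷ []
  delaysT c μ δ loc acc (itm1 p t) =
    (acc + c loc (μ p) + δ) ∷ delaysT c μ δ (μ p) (acc + c loc (μ p) + δ) t
  delaysT c μ δ loc acc (pt m k)   = delaysK c μ δ m (acc + c loc m) k

  delaysK : ∀ {n M} → (M → M → ℚ) → (Fin n → M) → ℚ → M → ℚ → Kids n M → List ℚ
  delaysK c μ δ loc acc k0       = []
  delaysK c μ δ loc acc (k1 t)   = delaysT c μ δ loc acc t
  delaysK c μ δ loc acc (k2 t u) =
    let acc' = acc + toℚ (length (itemsT t) ⊓ length (itemsT u))
    in delaysT c μ δ loc acc' t ++ delaysT c μ δ loc acc' u

-- A valid schedule: every item of P occurs exactly once (vertex set contains P).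
ValidSchedule : ∀ {n M} → Schedule n M → Set
ValidSchedule {n} s = itemsK s ↭ allFin n

DelayAtMost : ∀ {n M} → (M → M → ℚ) → (r : M) → (Fin n → M) → ℚ → Schedule n M → ℚ → Set
DelayAtMost c r μ δ s Δ = All (_≤ Δ) (delaysK c μ δ r 0ℚ s)

Feasible : ∀ {n M} → (M → M → ℚ) → (r : M) → (Fin n → M) → ℚ → ℚ → Set
Feasible {n} {M} c r μ δ Δ =
  Σ (Schedule n M) (λ s → ValidSchedule s × DelayAtMost c r μ δ s Δ)

{-# OPTIONS --safe #-}
-- Call a subtree entered from location ℓ with accumulated delay d, holding k ≥ 1
-- items of Q among its L items, good if for some q ∈ Q one of its items has delay
-- at least d + c(ℓ, q) + δ + min(k, L − 1).  Every such subtree is good, by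
-- structural induction: a vertex outside P is absorbed by the triangle inequality,
-- an item on the path contributes δ ≥ 1 towards the min, and at a fork the charge
-- min(a, b) of two branches of sizes a, b pays for the items of Q in the branch
-- not followed.  At the root, with k = |Q| and L = n + 1, this is (a); (b) and (c)
-- are (a) for Q = P and Q = {p}.
module Submission where

open import Defs
open import Data.Nat.Base as ℕ using (ℕ; zero; suc; pred; _⊓_; _∸_; z≤n; s≤s)
import Data.Nat.Properties as ℕ
open import Data.Integer.Base as ℤ using (+_)
import Data.Integer.Properties as ℤ
open import Data.Rational.Base using (ℚ; _+_; _≤_; 0ℚ; 1ℚ; toℚᵘ)
open import Data.Rational.Properties
  using (≤-reflexive; ≤-trans; +-monoˡ-≤; +-monoʳ-≤; +-assoc; +-identityˡ; +-identityʳ;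
         toℚᵘ-injective; toℚᵘ-fromℚᵘ; toℚᵘ-homo-+; nonNegative⁻¹; normalize-nonNeg;
         module ≤-Reasoning)
import Data.Rational.Unnormalised.Base as ℚᵘ
import Data.Rational.Unnormalised.Properties as ℚᵘ
open import Data.Rational.Solver using (module +-*-Solver)
open import Data.Bool.Base using (true; false)
open import Data.Fin.Base as Fin using (Fin)
open import Data.Fin.Subset using (Subset; Nonempty; ∣_∣; _∈_; _∉_; ⊤; ⁅_⁆)
open import Data.Fin.Subset.Properties using (_∈?_; ∈⊤; ∣⊤∣≡n; x∈⁅x⁆; x∈⁅y⁆⇒x≡y)
open import Data.Vec.Base using ([]; _∷_)
open import Data.List.Base using (List; []; _∷_; _++_; length; filter; tabulate; allFin)
open import Function.Base using (id; _∘_)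
import Data.List.Properties as List
open import Data.List.Membership.Propositional using (lose) renaming (_∈_ to _∈ˡ_)
open import Data.List.Membership.Propositional.Properties using (∈-allFin)
open import Data.List.Relation.Unary.Any as Any using (Any; here; there)
open import Data.List.Relation.Unary.Any.Properties using (++⁺ˡ; ++⁺ʳ)
open import Data.List.Relation.Unary.All using (lookupAny)
open import Data.List.Relation.Binary.Permutation.Propositional using (_↭_)
open import Data.List.Relation.Binary.Permutation.Propositional.Properties using (↭-length; filter-↭)
open import Data.Product.Base using (Σ; ∃-syntax; _×_; _,_; proj₁; proj₂)
open import Data.Sum.Base using (_⊎_; inj₁; inj₂; [_,_]′)
open import Relation.Nullary using (¬_; yes; no; does)
open import Relation.Nullary.Decidable using (decidable-stable)
open import Relation.Binary.PropositionalEquality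

m⊓n≤1+k⊓pred[n] : ∀ {m k} n → m ℕ.≤ suc k → m ⊓ n ℕ.≤ suc (k ⊓ pred n)
m⊓n≤1+k⊓pred[n] zero    _     = ℕ.≤-trans (ℕ.m⊓n≤n _ 0) z≤n
m⊓n≤1+k⊓pred[n] (suc n) m≤1+k = ℕ.⊓-monoˡ-≤ (suc n) m≤1+k

1≤m+n⇒1≤m⊎1≤n : ∀ m {n} → 1 ℕ.≤ m ℕ.+ n → 1 ℕ.≤ m ⊎ 1 ℕ.≤ n
1≤m+n⇒1≤m⊎1≤n zero    1≤n = inj₂ 1≤n
1≤m+n⇒1≤m⊎1≤n (suc m) _   = inj₁ (s≤s z≤n)

-- The branch the induction follows at a fork with subtrees of sizes a, b holding
-- qa, qb items of Q: one holding items of Q, the larger one if both do.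
Preferred : ℕ → ℕ → ℕ → ℕ → Set
Preferred qa qb a b = 1 ℕ.≤ qa × (qb ≡ 0 ⊎ b ℕ.≤ a)

preferred-side : ∀ qa qb a b → 1 ℕ.≤ qa ℕ.+ qb → Preferred qa qb a b ⊎ Preferred qb qa b a
preferred-side zero      qb       a b 1≤qb = inj₂ (1≤qb , inj₁ refl)
preferred-side (suc qa) zero      a b _    = inj₁ (s≤s z≤n , inj₁ refl)
preferred-side (suc qa) (suc qb) a b _ with ℕ.≤-total b a
... | inj₁ b≤a = inj₁ (s≤s z≤n , inj₂ b≤a)
... | inj₂ a≤b = inj₂ (s≤s z≤n , inj₂ a≤b)

preferred-split : ∀ {qa qb a b} → qa ℕ.≤ a → qb ℕ.≤ b → Preferred qa qb a b →
                  (qa ℕ.+ qb) ⊓ pred (a ℕ.+ b) ℕ.≤ a ⊓ b ℕ.+ qa ⊓ pred a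
preferred-split {suc qa} {qb} {suc a} {b} _ qb≤b (_ , inj₂ b≤a) = begin
  (suc qa ℕ.+ qb) ⊓ (a ℕ.+ b)   ≤⟨ ℕ.⊓-monoˡ-≤ (a ℕ.+ b) (ℕ.+-monoʳ-≤ (suc qa) qb≤b) ⟩
  (suc qa ℕ.+ b) ⊓ (a ℕ.+ b)    ≡⟨ ℕ.+-distribʳ-⊓ b (suc qa) a ⟨
  suc qa ⊓ a ℕ.+ b              ≡⟨ ℕ.+-comm (suc qa ⊓ a) b ⟩
  b ℕ.+ suc qa ⊓ a              ≡⟨ cong (ℕ._+ suc qa ⊓ a) (ℕ.m≥n⇒m⊓n≡n b≤a) ⟨
  suc a ⊓ b ℕ.+ suc qa ⊓ a      ∎
  where open ℕ.≤-Reasoning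
preferred-split {suc qa} {_} {suc a} {zero} _ _ (_ , inj₁ refl) =
  ℕ.≤-reflexive (cong₂ _⊓_ (ℕ.+-identityʳ (suc qa)) (ℕ.+-identityʳ a))
preferred-split {suc qa} {_} {suc a} {suc b} (s≤s qa≤a) _ (_ , inj₁ refl) = begin
  (suc qa ℕ.+ 0) ⊓ (a ℕ.+ suc b)  ≤⟨ ℕ.m⊓n≤m _ _ ⟩
  suc qa ℕ.+ 0                    ≡⟨ ℕ.+-identityʳ (suc qa) ⟩
  suc qa                          ≤⟨ s≤s (ℕ.⊓-glb (ℕ.n≤1+n qa) qa≤a) ⟩
  suc (suc qa ⊓ a)                ≤⟨ s≤s (ℕ.m≤n+m _ _) ⟩
  suc (a ⊓ b ℕ.+ suc qa ⊓ a)      ∎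
  where open ℕ.≤-Reasoning

fork-split : ∀ {qa qb a b} → qa ℕ.≤ a → qb ℕ.≤ b → 1 ℕ.≤ qa ℕ.+ qb →
             (1 ℕ.≤ qa × (qa ℕ.+ qb) ⊓ pred (a ℕ.+ b) ℕ.≤ a ⊓ b ℕ.+ qa ⊓ pred a) ⊎
             (1 ℕ.≤ qb × (qa ℕ.+ qb) ⊓ pred (a ℕ.+ b) ℕ.≤ a ⊓ b ℕ.+ qb ⊓ pred b)
fork-split {qa} {qb} {a} {b} qa≤a qb≤b 1≤qa+qb with preferred-side qa qb a b 1≤qa+qb
... | inj₁ pref@(1≤qa , _) = inj₁ (1≤qa , preferred-split qa≤a qb≤b pref)
... | inj₂ pref@(1≤qb , _) = inj₂ (1≤qb , (begin
  (qa ℕ.+ qb) ⊓ pred (a ℕ.+ b)  ≡⟨ cong₂ (λ k l → k ⊓ pred l) (ℕ.+-comm qa qb) (ℕ.+-comm a b) ⟩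
  (qb ℕ.+ qa) ⊓ pred (b ℕ.+ a)  ≤⟨ preferred-split qb≤b qa≤a pref ⟩
  b ⊓ a ℕ.+ qb ⊓ pred b         ≡⟨ cong (ℕ._+ qb ⊓ pred b) (ℕ.⊓-comm b a) ⟩
  a ⊓ b ℕ.+ qb ⊓ pred b         ∎))
  where open ℕ.≤-Reasoning

toℚ-+ : ∀ m n → toℚ (m ℕ.+ n) ≡ toℚ m + toℚ n
toℚ-+ m n = toℚᵘ-injective (begin
  toℚᵘ (toℚ (m ℕ.+ n))                  ≈⟨ toℚᵘ-toℚ (m ℕ.+ n) ⟩
  ℚᵘ.mkℚᵘ (+ (m ℕ.+ n)) 0               ≈⟨ ℚᵘ.*≡* (cong (ℤ._* + 1) +[m+n]≡+m*1++n*1) ⟩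
  ℚᵘ.mkℚᵘ (+ m) 0 ℚᵘ.+ ℚᵘ.mkℚᵘ (+ n) 0  ≈⟨ ℚᵘ.+-cong (toℚᵘ-toℚ m) (toℚᵘ-toℚ n) ⟨
  toℚᵘ (toℚ m) ℚᵘ.+ toℚᵘ (toℚ n)         ≈⟨ toℚᵘ-homo-+ (toℚ m) (toℚ n) ⟨
  toℚᵘ (toℚ m + toℚ n)                  ∎)
  where
  open ℚᵘ.≃-Reasoning
  toℚᵘ-toℚ : ∀ k → toℚᵘ (toℚ k) ℚᵘ.≃ ℚᵘ.mkℚᵘ (+ k) 0
  toℚᵘ-toℚ k = toℚᵘ-fromℚᵘ (ℚᵘ.mkℚᵘ (+ k) 0)
  +[m+n]≡+m*1++n*1 : + (m ℕ.+ n) ≡ + m ℤ.* + 1 ℤ.+ + n ℤ.* + 1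
  +[m+n]≡+m*1++n*1 =
    trans (ℤ.pos-+ m n) (sym (cong₂ ℤ._+_ (ℤ.*-identityʳ (+ m)) (ℤ.*-identityʳ (+ n))))

0≤toℚ : ∀ n → 0ℚ ≤ toℚ n
0≤toℚ n = nonNegative⁻¹ (toℚ n) {{normalize-nonNeg n 1}}

p≤p+q : ∀ p {q} → 0ℚ ≤ q → p ≤ p + q
p≤p+q p {q} 0≤q = begin
  p       ≡⟨ +-identityʳ p ⟨
  p + 0ℚ  ≤⟨ +-monoʳ-≤ p 0≤q ⟩
  p + q   ∎
  where open ≤-Reasoning

toℚ-mono-≤ : ∀ {m n} → m ℕ.≤ n → toℚ m ≤ toℚ n
toℚ-mono-≤ {m} {n} m≤n = begin
  toℚ m                ≤⟨ p≤p+q (toℚ m) (0≤toℚ (n ∸ m)) ⟩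
  toℚ m + toℚ (n ∸ m)  ≡⟨ toℚ-+ m (n ∸ m) ⟨
  toℚ (m ℕ.+ (n ∸ m))  ≡⟨ cong toℚ (ℕ.m+[n∸m]≡n m≤n) ⟩
  toℚ n                ∎
  where open ≤-Reasoning

toℚ-mono-+ : ∀ {m} n k → m ℕ.≤ n ℕ.+ k → toℚ m ≤ toℚ n + toℚ k
toℚ-mono-+ n k m≤n+k = ≤-trans (toℚ-mono-≤ m≤n+k) (≤-reflexive (toℚ-+ n k))

1+n≤x+δ+n : ∀ {x δ} n → 0ℚ ≤ x → 1ℚ ≤ δ → toℚ (suc n) ≤ x + δ + toℚ n
1+n≤x+δ+n {x} {δ} n 0≤x 1≤δ = begin
  toℚ (suc n)     ≡⟨ toℚ-+ 1 n ⟩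
  1ℚ + toℚ n      ≤⟨ +-monoˡ-≤ (toℚ n) 1≤δ ⟩
  δ + toℚ n       ≡⟨ cong (_+ toℚ n) (+-identityˡ δ) ⟨
  0ℚ + δ + toℚ n  ≤⟨ +-monoˡ-≤ (toℚ n) (+-monoˡ-≤ δ 0≤x) ⟩
  x + δ + toℚ n   ∎
  where open ≤-Reasoning

x≤x+δ+n : ∀ x {δ} n → 1ℚ ≤ δ → x ≤ x + δ + toℚ n
x≤x+δ+n x n 1≤δ = ≤-trans (p≤p+q x (≤-trans (0≤toℚ 1) 1≤δ)) (p≤p+q _ (0≤toℚ n))

count : ∀ {m} → Subset m → List (Fin m) → ℕ
count Q xs = length (filter (_∈? Q) xs)

module _ {m} (Q : Subset m) where

  count≤length : ∀ xs → count Q xs ℕ.≤ length xs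
  count≤length = List.length-filter (_∈? Q)

  count-++ : ∀ xs ys → count Q (xs ++ ys) ≡ count Q xs ℕ.+ count Q ys
  count-++ xs ys =
    trans (cong length (List.filter-++ (_∈? Q) xs ys)) (List.length-++ (filter (_∈? Q) xs))

  count-∷-≤ : ∀ x xs → count Q (x ∷ xs) ℕ.≤ suc (count Q xs)
  count-∷-≤ x xs with does (x ∈? Q)
  ... | true  = ℕ.≤-refl
  ... | false = ℕ.n≤1+n (count Q xs)

  count-∷-∉ : ∀ {x} xs → x ∉ Q → count Q (x ∷ xs) ≡ count Q xs
  count-∷-∉ xs x∉Q = cong length (List.filter-reject (_∈? Q) x∉Q)

  head∈-if-tail-uncounted : ∀ {x} xs → ¬ 1 ℕ.≤ count Q xs → 1 ℕ.≤ count Q (x ∷ xs) → x ∈ Q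
  head∈-if-tail-uncounted {x} xs 1≰count 1≤count = decidable-stable (x ∈? Q)
    (λ x∉Q → 1≰count (subst (1 ℕ.≤_) (count-∷-∉ xs x∉Q) 1≤count))

  count-↭ : ∀ {xs ys} → xs ↭ ys → count Q xs ≡ count Q ys
  count-↭ xs↭ys = ↭-length (filter-↭ (_∈? Q) xs↭ys)

  count-positive : ∀ {x xs} → x ∈ Q → x ∈ˡ xs → 1 ℕ.≤ count Q xs
  count-positive x∈Q x∈xs = List.filter-some (_∈? Q) (lose x∈xs x∈Q)

count-∷-tabulate-suc : ∀ {m k} s (Q : Subset m) (f : Fin k → Fin m) →
                       count (s ∷ Q) (tabulate (Fin.suc ∘ f)) ≡ count Q (tabulate f)
count-∷-tabulate-suc {k = zero}  s Q f = refl
count-∷-tabulate-suc {k = suc k} s Q f with does (f Fin.zero ∈? Q)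
... | true  = cong suc (count-∷-tabulate-suc s Q (f ∘ Fin.suc))
... | false = count-∷-tabulate-suc s Q (f ∘ Fin.suc)

count-allFin : ∀ {m} (Q : Subset m) → count Q (allFin m) ≡ ∣ Q ∣
count-allFin []          = refl
count-allFin (true ∷ Q)  = cong suc (trans (count-∷-tabulate-suc true Q id) (count-allFin Q))
count-allFin (false ∷ Q) = trans (count-∷-tabulate-suc false Q id) (count-allFin Q)

∣⊤∣⊓n≡n : ∀ n → ∣ ⊤ {suc n} ∣ ⊓ n ≡ n
∣⊤∣⊓n≡n n = trans (cong (_⊓ n) (∣⊤∣≡n (suc n))) (ℕ.m≥n⇒m⊓n≡n (ℕ.n≤1+n n))

module DelayBounds {m} {M : Set} (c : M → M → ℚ) (c-metric : IsMetric c)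
                   (μ : Fin m → M) (δ : ℚ) (1≤δ : 1ℚ ≤ δ) where

  open IsMetric c-metric using (nonneg; triangle)

  bound : ℚ → ℚ → ℕ → ℚ
  bound acc dist g = acc + dist + δ + toℚ g

  some-≥-weaken : ∀ {x y ds} → x ≤ y → Any (y ≤_) ds → Any (x ≤_) ds
  some-≥-weaken x≤y = Any.map (≤-trans x≤y)

  bound-≤-item-delay : ∀ acc dist {g} → g ℕ.≤ 0 → bound acc dist g ≤ acc + dist + δ
  bound-≤-item-delay acc dist g≤0 =
    ≤-trans (+-monoʳ-≤ (acc + dist + δ) (toℚ-mono-≤ g≤0))
            (≤-reflexive (+-identityʳ (acc + dist + δ)))

  distance-into-offset : ∀ acc {x y z} g → x ≤ y + z → bound acc x g ≤ bound (acc + y) z g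
  distance-into-offset acc {x} {y} {z} g x≤y+z = begin
    acc + x + δ + toℚ g        ≤⟨ +-monoˡ-≤ (toℚ g) (+-monoˡ-≤ δ (+-monoʳ-≤ acc x≤y+z)) ⟩
    acc + (y + z) + δ + toℚ g  ≡⟨ cong (λ w → w + δ + toℚ g) (+-assoc acc y z) ⟨
    acc + y + z + δ + toℚ g    ∎
    where open ≤-Reasoning

  count-into-offset : ∀ acc x {e g g′} → toℚ g ≤ e + toℚ g′ →
                      bound acc x g ≤ bound (acc + e) x g′
  count-into-offset acc x {e} {g} {g′} g≤e+g′ = begin
    acc + x + δ + toℚ g         ≤⟨ +-monoʳ-≤ (acc + x + δ) g≤e+g′ ⟩
    acc + x + δ + (e + toℚ g′)  ≡⟨ solve 5 (λ a x d e h → a :+ x :+ d :+ (e :+ h) := a :+ e :+ x :+ d :+ h)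
                                          refl acc x δ e (toℚ g′) ⟩
    acc + e + x + δ + toℚ g′    ∎
    where
    open ≤-Reasoning
    open +-*-Solver

  item-step : ∀ acc loc x y {g g′} → g ℕ.≤ suc g′ →
              bound acc (c loc y) g ≤ bound (acc + c loc x + δ) (c x y) g′
  item-step acc loc x y {g} {g′} g≤1+g′ =
    ≤-trans (distance-into-offset acc g (triangle loc x y))
            (count-into-offset (acc + c loc x) (c x y) {g = g} {g′}
              (≤-trans (toℚ-mono-+ 1 g′ g≤1+g′) (+-monoˡ-≤ (toℚ g′) 1≤δ)))

  offset+δ≤ : ∀ acc {e} → 0ℚ ≤ e → acc + δ ≤ acc + e + δ
  offset+δ≤ acc 0≤e = +-monoˡ-≤ δ (p≤p+q acc 0≤e)

  mutual
    some-delay-≥ᵀ : ∀ t loc acc → 1 ℕ.≤ length (itemsT t) →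
                    Any (acc + δ ≤_) (delaysT c μ δ loc acc t)
    some-delay-≥ᵀ (itm0 p)   loc acc _     = here (offset+δ≤ acc (nonneg loc (μ p)))
    some-delay-≥ᵀ (itm1 p t) loc acc _     = here (offset+δ≤ acc (nonneg loc (μ p)))
    some-delay-≥ᵀ (pt x k)   loc acc 1≤|k| =
      some-≥-weaken (offset+δ≤ acc (nonneg loc x)) (some-delay-≥ᴷ k x (acc + c loc x) 1≤|k|)

    some-delay-≥ᴷ : ∀ k loc acc → 1 ℕ.≤ length (itemsK k) →
                    Any (acc + δ ≤_) (delaysK c μ δ loc acc k)
    some-delay-≥ᴷ k0       loc acc ()
    some-delay-≥ᴷ (k1 t)   loc acc 1≤|t|   = some-delay-≥ᵀ t loc acc 1≤|t|
    some-delay-≥ᴷ (k2 t u) loc acc 1≤|tu| =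
      [ (λ 1≤|t| → ++⁺ˡ (some-≥-weaken fork (some-delay-≥ᵀ t loc acc′ 1≤|t|)))
      , (λ 1≤|u| → ++⁺ʳ _ (some-≥-weaken fork (some-delay-≥ᵀ u loc acc′ 1≤|u|)))
      ]′ (1≤m+n⇒1≤m⊎1≤n (length (itemsT t))
                         (subst (1 ℕ.≤_) (List.length-++ (itemsT t)) 1≤|tu|))
      where
      acc′ : ℚ
      acc′ = acc + toℚ (length (itemsT t) ⊓ length (itemsT u))
      fork : acc + δ ≤ acc′ + δ
      fork = offset+δ≤ acc (0≤toℚ (length (itemsT t) ⊓ length (itemsT u)))

  itm1-delay-bound : ∀ p t loc acc {g} → g ℕ.≤ 1 ⊓ length (itemsT t) →
                     Any (bound acc (c loc (μ p)) g ≤_) (delaysT c μ δ loc acc (itm1 p t))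
  itm1-delay-bound p t loc acc {g} g≤1⊓|t| with 1 ℕ.≤? length (itemsT t)
  ... | yes 1≤|t| = there (some-≥-weaken g≤δ (some-delay-≥ᵀ t (μ p) (acc + c loc (μ p) + δ) 1≤|t|))
    where
    g≤δ : bound acc (c loc (μ p)) g ≤ acc + c loc (μ p) + δ + δ
    g≤δ = +-monoʳ-≤ (acc + c loc (μ p) + δ)
                    (≤-trans (toℚ-mono-≤ (ℕ.≤-trans g≤1⊓|t| (ℕ.m⊓n≤m 1 _))) 1≤δ)
  ... | no  1≰|t| = here (bound-≤-item-delay acc (c loc (μ p)) g≤0)
    where
    g≤0 : g ℕ.≤ 0
    g≤0 = ℕ.≤-trans g≤1⊓|t| (ℕ.≤-trans (ℕ.m⊓n≤n 1 _) (ℕ.≮⇒≥ 1≰|t|))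

  module _ (Q : Subset m) where

    quota : List (Fin m) → ℕ
    quota xs = count Q xs ⊓ pred (length xs)

    record DelayBound (ds : List ℚ) (loc : M) (acc : ℚ) (g : ℕ) : Set where
      constructor witness
      field
        {item}  : Fin m
        item∈Q  : item ∈ Q
        reached : Any (bound acc (c loc (μ item)) g ≤_) ds

    DelayBound-transport : ∀ {ds ds′ loc loc′ acc acc′ g g′} →
                           (∀ {x} → Any (x ≤_) ds → Any (x ≤_) ds′) →
                           (∀ q → bound acc′ (c loc′ (μ q)) g′ ≤ bound acc (c loc (μ q)) g) →
                           DelayBound ds loc acc g → DelayBound ds′ loc′ acc′ g′
    DelayBound-transport embed step (witness q∈Q reach) =
      witness q∈Q (embed (some-≥-weaken (step _) reach))

    fork-step : ∀ xs ys acc x {g′} →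
                (count Q xs ℕ.+ count Q ys) ⊓ pred (length xs ℕ.+ length ys)
                  ℕ.≤ length xs ⊓ length ys ℕ.+ g′ →
                bound acc x (quota (xs ++ ys)) ≤ bound (acc + toℚ (length xs ⊓ length ys)) x g′
    fork-step xs ys acc x {g′} split =
      count-into-offset acc x {g = quota (xs ++ ys)} {g′}
        (toℚ-mono-+ (length xs ⊓ length ys) g′ (ℕ.≤-trans (ℕ.≤-reflexive quota-++) split))
      where
      quota-++ : quota (xs ++ ys) ≡ (count Q xs ℕ.+ count Q ys) ⊓ pred (length xs ℕ.+ length ys)
      quota-++ = cong₂ (λ k l → k ⊓ pred l) (count-++ Q xs ys) (List.length-++ xs)

    mutual
      delay-boundᵀ : ∀ t loc acc → 1 ℕ.≤ count Q (itemsT t) →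
                     DelayBound (delaysT c μ δ loc acc t) loc acc (quota (itemsT t))
      delay-boundᵀ (itm0 p) loc acc 1≤q =
        witness (head∈-if-tail-uncounted Q [] (λ ()) 1≤q)
                (here (bound-≤-item-delay acc (c loc (μ p)) (ℕ.m⊓n≤n (count Q (p ∷ [])) 0)))
      delay-boundᵀ (itm1 p t) loc acc 1≤q with 1 ℕ.≤? count Q (itemsT t)
      ... | yes 1≤qt = DelayBound-transport there
            (λ q → item-step acc loc (μ p) (μ q)
                     (m⊓n≤1+k⊓pred[n] (length (itemsT t)) (count-∷-≤ Q p (itemsT t))))
            (delay-boundᵀ t (μ p) (acc + c loc (μ p) + δ) 1≤qt)
      ... | no 1≰qt = witness (head∈-if-tail-uncounted Q (itemsT t) 1≰qt 1≤q)
            (itm1-delay-bound p t loc acc (ℕ.⊓-monoˡ-≤ (length (itemsT t)) count≤1))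
        where
        count≤1 : count Q (p ∷ itemsT t) ℕ.≤ 1
        count≤1 = ℕ.≤-trans (count-∷-≤ Q p (itemsT t)) (s≤s (ℕ.≮⇒≥ 1≰qt))
      delay-boundᵀ (pt x k) loc acc 1≤q = DelayBound-transport id
        (λ q → distance-into-offset acc (quota (itemsK k)) (triangle loc x (μ q)))
        (delay-boundᴷ k x (acc + c loc x) 1≤q)

      delay-boundᴷ : ∀ k loc acc → 1 ℕ.≤ count Q (itemsK k) →
                     DelayBound (delaysK c μ δ loc acc k) loc acc (quota (itemsK k))
      delay-boundᴷ k0       loc acc ()
      delay-boundᴷ (k1 t)   loc acc 1≤q = delay-boundᵀ t loc acc 1≤q
      delay-boundᴷ (k2 t u) loc acc 1≤q =
        [ (λ (1≤qt , split) → DelayBound-transport ++⁺ˡ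
             (λ q → fork-step (itemsT t) (itemsT u) acc (c loc (μ q)) split)
             (delay-boundᵀ t loc acc′ 1≤qt))
        , (λ (1≤qu , split) → DelayBound-transport (++⁺ʳ _)
             (λ q → fork-step (itemsT t) (itemsT u) acc (c loc (μ q)) split)
             (delay-boundᵀ u loc acc′ 1≤qu))
        ]′ (fork-split (count≤length Q (itemsT t)) (count≤length Q (itemsT u))
                       (subst (1 ℕ.≤_) (count-++ Q (itemsT t) (itemsT u)) 1≤q))
        where
        acc′ : ℚ
        acc′ = acc + toℚ (length (itemsT t) ⊓ length (itemsT u))

    lower-bound : ∀ (s : Schedule m M) {r Δ} → ValidSchedule s → DelayAtMost c r μ δ s Δ →
                  Nonempty Q → ∃[ q ] q ∈ Q × (c r (μ q) + δ + toℚ (∣ Q ∣ ⊓ pred m) ≤ Δ)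
    lower-bound s {r} {Δ} valid delays≤Δ (x , x∈Q) = item , item∈Q , (begin
      c r (μ item) + δ + toℚ (∣ Q ∣ ⊓ pred m)   ≡⟨ cong (λ z → z + δ + _) (+-identityˡ (c r (μ item))) ⟨
      bound 0ℚ (c r (μ item)) (∣ Q ∣ ⊓ pred m)  ≡⟨ cong (bound 0ℚ (c r (μ item))) quota≡ ⟨
      bound 0ℚ (c r (μ item)) (quota (itemsK s)) ≤⟨ proj₂ (lookupAny delays≤Δ reached) ⟩
      Any.lookup reached                        ≤⟨ proj₁ (lookupAny delays≤Δ reached) ⟩
      Δ                                         ∎)
      where
      open ≤-Reasoning
      quota≡ : quota (itemsK s) ≡ ∣ Q ∣ ⊓ pred m
      quota≡ = cong₂ (λ k l → k ⊓ pred l) (trans (count-↭ Q valid) (count-allFin Q))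
                                          (trans (↭-length valid) (List.length-tabulate {n = m} id))
      1≤count : 1 ℕ.≤ count Q (itemsK s)
      1≤count = subst (1 ℕ.≤_) (sym (count-↭ Q valid)) (count-positive Q x∈Q (∈-allFin x))
      open DelayBound (delay-boundᴷ s r 0ℚ 1≤count)

corollary5 : (n : ℕ) → (M : Set) → (c : M → M → ℚ) → IsMetric c
    → (r : M) → (μ : Fin (suc n) → M) → (δ σ Δ : ℚ)
    → 1ℚ ≤ δ → 0ℚ ≤ σ → 0ℚ ≤ Δ
    → Feasible c r μ δ Δ
    → ((Q : Subset (suc n)) → Nonempty Q
         → Σ (Fin (suc n)) (λ q → q ∈ Q × (c r (μ q) + δ + toℚ (∣ Q ∣ ⊓ n) ≤ Δ)))
      × toℚ (suc n) ≤ Δ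
      × ((p : Fin (suc n)) → c r (μ p) ≤ Δ)
corollary5 n M c c-metric r μ δ _ Δ 1≤δ _ _ (s , valid , delays≤Δ) = part-a , part-b , part-c
  where
  open IsMetric c-metric using (nonneg)
  open DelayBounds c c-metric μ δ 1≤δ using (lower-bound)

  part-a : (Q : Subset (suc n)) → Nonempty Q →
           ∃[ q ] q ∈ Q × (c r (μ q) + δ + toℚ (∣ Q ∣ ⊓ n) ≤ Δ)
  part-a Q = lower-bound Q s valid delays≤Δ

  part-b : toℚ (suc n) ≤ Δ
  part-b with part-a ⊤ (Fin.zero , ∈⊤)
  ... | q , _ , bound≤Δ = ≤-trans (1+n≤x+δ+n n (nonneg r (μ q)) 1≤δ)
                                  (subst (λ k → c r (μ q) + δ + toℚ k ≤ Δ) (∣⊤∣⊓n≡n n) bound≤Δ)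

  part-c : (p : Fin (suc n)) → c r (μ p) ≤ Δ
  part-c p with part-a ⁅ p ⁆ (p , x∈⁅x⁆ p)
  ... | q , q∈⁅p⁆ , bound≤Δ rewrite x∈⁅y⁆⇒x≡y p q∈⁅p⁆ =
    ≤-trans (x≤x+δ+n (c r (μ p)) (∣ ⁅ p ⁆ ∣ ⊓ n) 1≤δ) bound≤Δ
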